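{- Let $k$ be a positive integer, $a=6k+3$ and $S=\{a,a+2,2a-2\}=\{6k+3,6k+5,12k+4\}$. Then $x\in\langle S\rangle$ if and only if $x=(q+2u)a+2r-2u$ for some $q,r,u\in\mathbb{N}$ with $0\le r\le q$; moreover $\langle S\rangle$ is a $3$-permutation numerical semigroup.
   Context: A numerical semigroup is a submonoid $G$ of $(\mathbb{N},+,0)$ with $\mathbb{N}\setminus G$ finite; $\langle S\rangle$ is the submonoid generated by $S$. Write the elements of $G$ as $0=g_0<g_1<g_2<\cdots$. For $n\ge 1$, $G$ is an $n$-permutation numerical semigroup if $G=\langle g_1,\dots,g_n\rangle$ and for every integer $k\ge 0$ the tuple $(g_{kn+1}\bmod n,\dots,g_{kn+n}\bmod n)$ contains exactly one representative of each residue class of $\mathbb{Z}/n\mathbb{Z}$. -}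

module Defs where

open import Data.Nat using (ℕ; zero; suc; _+_; _*_; _≤_; _<_; NonZero)
open import Data.Nat.DivMod using (_%_)
open import Data.Fin using (Fin; toℕ)
open import Data.List using (List; map; allFin)
open import Data.List.Membership.Propositional using (_∈_)
open import Data.Product using (Σ; ∃; _×_)
open import Function.Bundles using (_⇔_)
open import Relation.Nullary using (¬_)
open import Relation.Binary.PropositionalEquality using (_≡_)

Pred : Set₁
Pred = ℕ → Set

data ⟨_⟩ (S : List ℕ) : ℕ → Set where
  gen-zero : ⟨ S ⟩ 0
  gen-step : ∀ {g x} → g ∈ S → ⟨ S ⟩ x → ⟨ S ⟩ (g + x)

IsNumericalSemigroup : Pred → Set
IsNumericalSemigroup G =
  G 0 × (∀ x y → G x → G y → G (x + y)) × (∃ λ N → ∀ x → N ≤ x → G x)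

-- Nth G i x : x is the i-th element g_i of G in increasing order (g_0 the least).
data Nth (G : Pred) : ℕ → ℕ → Set where
  nth-zero : ∀ {x} → G x → (∀ y → G y → x ≤ y) → Nth G 0 x
  nth-suc  : ∀ {i x y} → Nth G i x → G y → x < y →
             (∀ z → G z → x < z → y ≤ z) → Nth G (suc i) y

IsPermutationNS : (n : ℕ) → .{{NonZero n}} → Pred → Set
IsPermutationNS n G =
  IsNumericalSemigroup G ×
  Σ (ℕ → ℕ) λ g →
    (∀ i → Nth G i (g i)) ×
    (∀ x → G x ⇔ ⟨ map (λ (j : Fin n) → g (suc (toℕ j))) (allFin n) ⟩ x) ×
    (∀ k →
      (∀ r → r < n → Σ (Fin n) λ j → g (k * n + suc (toℕ j)) % n ≡ r) ×
      (∀ (j j′ : Fin n) →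
         g (k * n + suc (toℕ j)) % n ≡ g (k * n + suc (toℕ j′)) % n → j ≡ j′))

-- Put A = a − 1 = 6k + 2.  Adding one generator at a time shows that 2y ∈ ⟨S⟩ iff y = pA + s with
-- s ≤ 3p, and 2y + 1 ∈ ⟨S⟩ iff y = pA + 3k + 1 + s with s ≤ 3p + 1.  The 3-permutation property says
-- that, listing ⟨S⟩ in increasing order and recording the residues mod 3 used by the current block of
-- three, no residue is ever repeated.  On each interval pA ≤ y < (p + 1)A the pair
-- (2y ∈ ⟨S⟩, 2y + 1 ∈ ⟨S⟩) is constant on at most four stretches, laid out in one of four ways according
-- as p < k, p = k, k < p ≤ 2k or p > 2k (where every number is in ⟨S⟩).  Along a constant stretch the
-- recording state is 3-periodic, so each interval is a finite computation from a fixed state at pA to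
-- a fixed state at (p + 1)A.
module Submission where

open import Defs
open import Data.Bool using (Bool; true; false; if_then_else_)
open import Data.Bool.Properties using () renaming (_≟_ to _≟ᵇ_)
open import Data.Empty using (⊥-elim)
open import Data.Fin using (Fin; zero; suc; toℕ; fromℕ<)
open import Data.Fin.Properties using (all?; any?; toℕ-injective; toℕ-fromℕ<) renaming (_≟_ to _≟ᶠ_)
open import Data.Fin.Subset as Subset using (Subset; inside; ⁅_⁆)
open import Data.List using (List; []; _∷_)
open import Data.List.Membership.Propositional using (_∈_)
open import Data.List.Relation.Unary.Any using (here; there)
open import Data.Maybe using (Maybe; just; nothing; _>>=_)
import Data.Maybe.Properties as Maybe
open import Data.Nat using (ℕ; zero; suc; _+_; _*_; _∸_; _≤_; _<_; z≤n; s≤s)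
open import Data.Nat.DivMod
  using (_%_; _/_; [m+n]%n≡m%n; [m+kn]%n≡m%n; m<n⇒m%n≡m; m*n%n≡0; m%n<n; m≡m%n+[m/n]*n;
         +-distrib-/; m*n/n≡m; m<n⇒m/n≡0; /-monoˡ-≤)
open import Data.Nat.Properties
open import Data.Nat.Tactic.RingSolver using (solve-∀)
open import Data.Product using (Σ; ∃; _×_; _,_; proj₁; proj₂)
import Data.Product.Properties as Product
open import Data.Sum using (_⊎_; inj₁; inj₂)
open import Data.Unit using (⊤; tt)
open import Data.Vec using ([]; _∷_; lookup; tabulate; _[_]≔_)
import Data.Vec.Properties as Vec
open import Data.Vec.Properties using (lookup∘tabulate)
open import Function using (_∘_)
open import Function.Bundles using (_⇔_; mk⇔)
open import Relation.Binary using (DecidableEquality)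
open import Relation.Binary.PropositionalEquality
open import Relation.Nullary using (¬_; yes; no; does; ¬?; contradiction)
open import Relation.Nullary.Decidable using (Dec; toWitness; dec-true; dec-false; _×-dec_; _⊎-dec_; _→-dec_)

m+o≡n⇒m≤n : ∀ {m n} d → m + d ≡ n → m ≤ n
m+o≡n⇒m≤n {m} d refl = m≤m+n m d

dec-true⁻¹ : {P : Set} (P? : Dec P) → does P? ≡ true → P
dec-true⁻¹ (yes p) _ = p

m<n+1⇒m≤n : ∀ {m} n → m < n + 1 → m ≤ n
m<n+1⇒m≤n {m} n m<n+1 = m<1+n⇒m≤n (subst (m <_) (+-comm n 1) m<n+1)

pattern 0₃ = zero
pattern 1₃ = suc zero
pattern 2₃ = suc (suc zero)

rotate : Fin 3 → Fin 3
rotate 0₃ = 1₃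
rotate 1₃ = 2₃
rotate 2₃ = 0₃

residue : ℕ → Fin 3
residue zero = 0₃
residue (suc n) = rotate (residue n)

rotate³ : ∀ c → rotate (rotate (rotate c)) ≡ c
rotate³ 0₃ = refl
rotate³ 1₃ = refl
rotate³ 2₃ = refl

toℕ-residue : ∀ n → toℕ (residue n) ≡ n % 3
toℕ-residue 0 = refl
toℕ-residue 1 = refl
toℕ-residue 2 = refl
toℕ-residue (suc (suc (suc n))) = begin
  toℕ (rotate (rotate (rotate (residue n)))) ≡⟨ cong toℕ (rotate³ (residue n)) ⟩
  toℕ (residue n)                            ≡⟨ toℕ-residue n ⟩
  n % 3                                      ≡⟨ [m+n]%n≡m%n n 3 ⟨
  (n + 3) % 3                                ≡⟨ cong (_% 3) (+-comm n 3) ⟩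
  (3 + n) % 3                                ∎
  where open ≡-Reasoning

iterate : {A : Set} → (A → A) → ℕ → A → A
iterate f zero x = x
iterate f (suc n) x = iterate f n (f x)

iterate-+ : {A : Set} (f : A → A) (m n : ℕ) (x : A) →
            iterate f (m + n) x ≡ iterate f n (iterate f m x)
iterate-+ f zero n x = refl
iterate-+ f (suc m) n x = iterate-+ f m n (f x)

iterate-periodic : {A : Set} (f : A → A) (n : ℕ) {x : A} → iterate f n x ≡ x →
                   ∀ q r → iterate f (n * q + r) x ≡ iterate f r x
iterate-periodic f n {x} period zero r = cong (λ l → iterate f (l + r) x) (*-zeroʳ n)
iterate-periodic f n {x} period (suc q) r = begin
  iterate f (n * suc q + r) x           ≡⟨ cong (λ l → iterate f (l + r) x) (*-suc n q) ⟩
  iterate f (n + n * q + r) x           ≡⟨ cong (λ l → iterate f l x) (+-assoc n (n * q) r) ⟩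
  iterate f (n + (n * q + r)) x         ≡⟨ iterate-+ f n (n * q + r) x ⟩
  iterate f (n * q + r) (iterate f n x) ≡⟨ cong (iterate f (n * q + r)) period ⟩
  iterate f (n * q + r) x               ≡⟨ iterate-periodic f n period q r ⟩
  iterate f r x                         ∎
  where open ≡-Reasoning

-- Residue classes seen so far in the current block of three consecutive elements.
Seen : Set
Seen = Subset 3

_≟ˢ_ : DecidableEquality Seen
_≟ˢ_ = Vec.≡-dec _≟ᵇ_

_≟ₘ_ : DecidableEquality (Maybe Seen)
_≟ₘ_ = Maybe.≡-dec _≟ˢ_

∅ : Seen
∅ = Subset.⊥

allBut : Fin 3 → Seen
allBut c = Subset.∁ ⁅ c ⁆

mark : Fin 3 → Seen → Maybe Seen
mark c s = if lookup s c then nothing else just (restart (s [ c ]≔ inside))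
  where
  restart : Seen → Seen
  restart t = if does (t ≟ˢ Subset.⊤) then ∅ else t

visit : Bool → Fin 3 → Maybe Seen → Maybe Seen
visit false c m = m
visit true c m = m >>= mark c

visit-nothing : ∀ b c → visit b c nothing ≡ nothing
visit-nothing false c = refl
visit-nothing true c = refl

markBlock : Fin 3 → Fin 3 → Fin 3 → Maybe Seen
markBlock c₁ c₂ c₃ = visit true c₃ (visit true c₂ (visit true c₁ (just ∅)))

Permutes : (Fin 3 → Fin 3) → Set
Permutes c = (∀ j j′ → c j ≡ c j′ → j ≡ j′) × (∀ t → ∃ λ j → c j ≡ t)

CompleteBlock : Fin 3 → Fin 3 → Fin 3 → Set
CompleteBlock c₁ c₂ c₃ = markBlock c₁ c₂ c₃ ≡ just ∅ × Permutes (lookup (c₁ ∷ c₂ ∷ c₃ ∷ []))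

block-complete : ∀ c₁ c₂ c₃ → markBlock c₁ c₂ c₃ ≢ nothing → CompleteBlock c₁ c₂ c₃
block-complete c₁ c₂ c₃ = toWitness {a? = decide} tt c₁ c₂ c₃
  where
  decide : Dec (∀ c₁ c₂ c₃ → markBlock c₁ c₂ c₃ ≢ nothing → CompleteBlock c₁ c₂ c₃)
  decide = all? λ c₁ → all? λ c₂ → all? λ c₃ →
    let c = lookup (c₁ ∷ c₂ ∷ c₃ ∷ []) in
    ¬? (markBlock c₁ c₂ c₃ ≟ₘ nothing) →-dec
      (markBlock c₁ c₂ c₃ ≟ₘ just ∅) ×-dec
      (all? λ j → all? λ j′ → (c j ≟ᶠ c j′) →-dec (j ≟ᶠ j′)) ×-dec
      (all? λ t → any? λ j → c j ≟ᶠ t)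

interleave : (ℕ → Bool) → (ℕ → Bool) → ℕ → Bool
interleave e o zero = e 0
interleave e o (suc zero) = o 0
interleave e o (suc (suc n)) = interleave (e ∘ suc) (o ∘ suc) n

interleave-even : ∀ e o y → interleave e o (2 * y) ≡ e y
interleave-even e o zero = refl
interleave-even e o (suc y) =
  trans (cong (interleave e o) (*-suc 2 y)) (interleave-even (e ∘ suc) (o ∘ suc) y)

interleave-odd : ∀ e o y → interleave e o (suc (2 * y)) ≡ o y
interleave-odd e o zero = refl
interleave-odd e o (suc y) =
  trans (cong (interleave e o ∘ suc) (*-suc 2 y)) (interleave-odd (e ∘ suc) (o ∘ suc) y)

Config : Set
Config = Fin 3 × Maybe Seen

_≟ᶜ_ : DecidableEquality Config
_≟ᶜ_ = Product.≡-dec _≟ᶠ_ _≟ₘ_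

-- One step y ↦ y + 1 of the scan, visiting 2y and 2y + 1; the residue is that of 2y.
pairStep : Bool × Bool → Config → Config
pairStep (b , c) (ψ , m) = rotate (rotate ψ) , visit c (rotate ψ) (visit b ψ m)

record Segment : Set where
  constructor segment
  field
    bits : Bool × Bool
    periods rest : ℕ

length : Segment → ℕ
length (segment _ q r) = 3 * q + r

totalLength : List Segment → ℕ
totalLength [] = 0
totalLength (s ∷ ss) = length s + totalLength ss

-- Each segment is first checked to be 3-periodic, so that its 3q + r steps act as r steps and q can
-- stay symbolic.
run : Config → List Segment → Maybe Config
run c [] = just c
run c (segment bits q r ∷ ss) with iterate (pairStep bits) 3 c ≟ᶜ c
... | yes _ = run (iterate (pairStep bits) r c) ss
... | no _ = nothing

record FirstMemberFrom (member : ℕ → Bool) (n y : ℕ) : Set where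
  field
    is-member : member y ≡ true
    from : n ≤ y
    first : ∀ z → n ≤ z → z < y → member z ≡ false

first-unique : ∀ {member n y y′} → FirstMemberFrom member n y → FirstMemberFrom member n y′ → y ≡ y′
first-unique p p′ = ≤-antisym (≮⇒≥ (not-before p p′)) (≮⇒≥ (not-before p′ p))
  where
  open FirstMemberFrom
  not-before : ∀ {member n y y′} → FirstMemberFrom member n y → FirstMemberFrom member n y′ → ¬ y′ < y
  not-before p p′ y′<y with trans (sym (is-member p′)) (first p _ (from p′) y′<y)
  ... | ()

module Enumeration (member : ℕ → Bool) (zero-member : member 0 ≡ true)
                   (gap : ℕ) (1≤gap : 1 ≤ gap) (closed : ∀ x → member x ≡ true → member (gap + x) ≡ true) where
  open FirstMemberFrom

  search : ℕ → ℕ → ℕ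
  search n zero = n
  search n (suc f) = if member n then n else search (suc n) f

  search-first : ∀ f n m → n ≤ m → m < f + n → member m ≡ true → FirstMemberFrom member n (search n f)
  search-first zero n m n≤m m<n _ = ⊥-elim (<⇒≱ m<n n≤m)
  search-first (suc f) n m n≤m m<f+n m-member with member n in n-member
  ... | true = record { is-member = n-member ; from = ≤-refl ; first = λ z n≤z z<n → ⊥-elim (<⇒≱ z<n n≤z) }
  ... | false = record { is-member = is-member rest ; from = ≤-trans (n≤1+n n) (from rest) ; first = first′ }
    where
    n<m : n < m
    n<m = ≤∧≢⇒< n≤m λ { refl → contradiction (trans (sym n-member) m-member) λ () }
    rest : FirstMemberFrom member (suc n) (search (suc n) f)
    rest = search-first f (suc n) m n<m (subst (m <_) (sym (+-suc f n)) m<f+n) m-member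
    first′ : ∀ z → n ≤ z → z < search (suc n) f → member z ≡ false
    first′ z n≤z z<s with n ≟ z
    ... | yes refl = n-member
    ... | no n≢z = first rest z (≤∧≢⇒< n≤z n≢z) z<s

  enum : ℕ → ℕ
  enum zero = 0
  enum (suc i) = search (suc (enum i)) gap

  enum-member : ∀ i → member (enum i) ≡ true
  enum-next : ∀ i → FirstMemberFrom member (suc (enum i)) (enum (suc i))
  enum-member zero = zero-member
  enum-member (suc i) = is-member (enum-next i)
  enum-next i = search-first gap (suc (enum i)) (gap + enum i)
    (+-monoˡ-≤ (enum i) 1≤gap) (+-monoʳ-< gap ≤-refl) (closed (enum i) (enum-member i))

  enum-nth : (G : Pred) → (∀ x → member x ≡ true → G x) → (∀ x → G x → member x ≡ true) →
             ∀ i → Nth G i (enum i)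
  enum-nth G sound complete zero = nth-zero (sound 0 zero-member) λ _ _ → z≤n
  enum-nth G sound complete (suc i) =
    nth-suc (enum-nth G sound complete i) (sound _ (enum-member (suc i))) (from (enum-next i))
      λ z Gz i<z → ≮⇒≥ λ z<next → contradiction (trans (sym (complete z Gz)) (first (enum-next i) z i<z z<next)) λ ()

-- Scanning starts as if residues 1 and 2 had been seen, so that the element 0 closes a block.
module Scan (e o : ℕ → Bool) where

  member : ℕ → Bool
  member = interleave e o

  scan : ℕ → Maybe Seen
  scan zero = just (allBut 0₃)
  scan (suc x) = visit (member x) (residue x) (scan x)

  scan-nothing : ∀ x d → scan x ≡ nothing → scan (d + x) ≡ nothing
  scan-nothing x zero stuck = stuck
  scan-nothing x (suc d) stuck =
    trans (cong (visit (member (d + x)) (residue (d + x))) (scan-nothing x d stuck))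
          (visit-nothing (member (d + x)) (residue (d + x)))

  scan-never-fails : (∀ n → ∃ λ x → n ≤ x × scan x ≢ nothing) → ∀ x → scan x ≢ nothing
  scan-never-fails later x stuck with later x
  ... | y , x≤y , ok with m≤n⇒∃[o]m+o≡n x≤y
  ...   | d , refl = ok (trans (cong scan (+-comm x d)) (scan-nothing x d stuck))

  config : ℕ → Config
  config y = residue (2 * y) , scan (2 * y)

  config-suc : ∀ y → config (suc y) ≡ pairStep (e y , o y) (config y)
  config-suc y = trans (cong (λ x → residue x , scan x) (*-suc 2 y))
    (cong₂ (λ b c → pairStep (b , c) (config y)) (interleave-even e o y) (interleave-odd e o y))

  config-constant : ∀ bits L y → (∀ j → j < L → (e (y + j) , o (y + j)) ≡ bits) →
                    config (y + L) ≡ iterate (pairStep bits) L (config y)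
  config-constant bits zero y _ = cong config (+-identityʳ y)
  config-constant bits (suc L) y constant = begin
    config (y + suc L)                                          ≡⟨ cong config (+-suc y L) ⟩
    config (suc y + L)                                          ≡⟨ config-constant bits L (suc y) shifted ⟩
    iterate (pairStep bits) L (config (suc y))                  ≡⟨ cong (iterate (pairStep bits) L) (config-suc y) ⟩
    iterate (pairStep bits) L (pairStep (e y , o y) (config y)) ≡⟨ cong (λ b → iterate (pairStep bits) L (pairStep b (config y)))
                                                                        first ⟩
    iterate (pairStep bits) (suc L) (config y)                  ∎
    where
    open ≡-Reasoning
    first : (e y , o y) ≡ bits
    first = subst (λ z → (e z , o z) ≡ bits) (+-identityʳ y) (constant 0 (s≤s z≤n))
    shifted : ∀ j → j < L → (e (suc y + j) , o (suc y + j)) ≡ bits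
    shifted j j<L = subst (λ z → (e z , o z) ≡ bits) (+-suc y j) (constant (suc j) (s≤s j<L))

  Matches : ℕ → List Segment → Set
  Matches y [] = ⊤
  Matches y (segment bits q r ∷ ss) =
    (∀ j → j < 3 * q + r → (e (y + j) , o (y + j)) ≡ bits) × Matches (y + (3 * q + r)) ss

  config-run : ∀ ss y {c} → Matches y ss → run (config y) ss ≡ just c → config (y + totalLength ss) ≡ c
  config-run [] y _ refl = cong config (+-identityʳ y)
  config-run (segment bits q r ∷ ss) y {c} (constant , rest) ran
    with iterate (pairStep bits) 3 (config y) ≟ᶜ config y
  ... | yes periodic = begin
    config (y + (3 * q + r + totalLength ss)) ≡⟨ cong config (+-assoc y (3 * q + r) (totalLength ss)) ⟨
    config (y + (3 * q + r) + totalLength ss) ≡⟨ config-run ss (y + (3 * q + r)) rest ran′ ⟩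
    c                                         ∎
    where
    open ≡-Reasoning
    end : config (y + (3 * q + r)) ≡ iterate (pairStep bits) r (config y)
    end = trans (config-constant bits (3 * q + r) y constant) (iterate-periodic (pairStep bits) 3 periodic q r)
    ran′ : run (config (y + (3 * q + r))) ss ≡ just c
    ran′ = trans (cong (λ c′ → run c′ ss) end) ran
  ... | no _ with () ← ran

  scan-skip : ∀ x d → (∀ z → x ≤ z → z < d + x → member z ≡ false) → scan (d + x) ≡ scan x
  scan-skip x zero _ = refl
  scan-skip x (suc d) none =
    trans (cong (λ b → visit b (residue (d + x)) (scan (d + x))) (none (d + x) (m≤n+m x d) ≤-refl))
          (scan-skip x d λ z x≤z z<d+x → none z x≤z (m<n⇒m<1+n z<d+x))

  module Enumerated (g : ℕ → ℕ) (g-zero : g 0 ≡ 0) (zero-member : member 0 ≡ true)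
                    (g-next : ∀ i → FirstMemberFrom member (suc (g i)) (g (suc i)))
                    (no-failure : ∀ x → scan x ≢ nothing) where
    open FirstMemberFrom

    scan-next : ∀ i → scan (suc (g (suc i))) ≡ visit true (residue (g (suc i))) (scan (suc (g i)))
    scan-next i with m≤n⇒∃[o]m+o≡n (from (g-next i))
    ... | d , gap = begin
      visit (member (g (suc i))) c (scan (g (suc i))) ≡⟨ cong (λ b → visit b c (scan (g (suc i)))) (is-member (g-next i)) ⟩
      visit true c (scan (g (suc i)))                 ≡⟨ cong (visit true c ∘ scan) (trans (sym gap) (+-comm (suc (g i)) d)) ⟩
      visit true c (scan (d + suc (g i)))             ≡⟨ cong (visit true c) (scan-skip (suc (g i)) d none) ⟩
      visit true c (scan (suc (g i)))                 ∎
      where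
      open ≡-Reasoning
      c : Fin 3
      c = residue (g (suc i))
      none : ∀ z → suc (g i) ≤ z → z < d + suc (g i) → member z ≡ false
      none z lo hi = first (g-next i) z lo (subst (z <_) (trans (+-comm d _) gap) hi)

    blockResidue : ℕ → Fin 3 → Fin 3
    blockResidue m j = residue (g (suc (toℕ j + m * 3)))

    scan-block : ∀ m → scan (suc (g (m * 3))) ≡ just ∅ →
                 scan (suc (g (suc m * 3))) ≡ markBlock (blockResidue m 0₃) (blockResidue m 1₃) (blockResidue m 2₃)
    scan-block m start =
      trans (scan-next (2 + m * 3))
     (trans (cong (visit true c₃) (scan-next (1 + m * 3)))
     (trans (cong (visit true c₃ ∘ visit true c₂) (scan-next (m * 3)))
            (cong (visit true c₃ ∘ visit true c₂ ∘ visit true c₁) start)))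
      where
      c₁ c₂ c₃ : Fin 3
      c₁ = blockResidue m 0₃
      c₂ = blockResidue m 1₃
      c₃ = blockResidue m 2₃

    block-complete-at : ∀ m → scan (suc (g (m * 3))) ≡ just ∅ →
                        CompleteBlock (blockResidue m 0₃) (blockResidue m 1₃) (blockResidue m 2₃)
    block-complete-at m start =
      block-complete _ _ _ λ fail → no-failure (suc (g (suc m * 3))) (trans (scan-block m start) fail)

    block-start : ∀ m → scan (suc (g (m * 3))) ≡ just ∅
    block-start zero rewrite g-zero | zero-member = refl
    block-start (suc m) = trans (scan-block m (block-start m)) (proj₁ (block-complete-at m (block-start m)))

    residues-permute : ∀ m →
      (∀ r → r < 3 → Σ (Fin 3) λ j → g (m * 3 + suc (toℕ j)) % 3 ≡ r) ×
      (∀ (j j′ : Fin 3) → g (m * 3 + suc (toℕ j)) % 3 ≡ g (m * 3 + suc (toℕ j′)) % 3 → j ≡ j′)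
    residues-permute m = onto , one-to-one
      where
      permutes : Permutes (lookup (tabulate (blockResidue m)))
      permutes = proj₂ (block-complete-at m (block-start m))
      residue-mod : ∀ j → g (m * 3 + suc (toℕ j)) % 3 ≡ toℕ (lookup (tabulate (blockResidue m)) j)
      residue-mod j = begin
        g (m * 3 + suc (toℕ j)) % 3             ≡⟨ cong (λ i → g i % 3) (+-suc (m * 3) (toℕ j)) ⟩
        g (suc (m * 3 + toℕ j)) % 3             ≡⟨ cong (λ i → g (suc i) % 3) (+-comm (m * 3) (toℕ j)) ⟩
        g (suc (toℕ j + m * 3)) % 3             ≡⟨ toℕ-residue (g (suc (toℕ j + m * 3))) ⟨
        toℕ (blockResidue m j)                  ≡⟨ cong toℕ (lookup∘tabulate (blockResidue m) j) ⟨
        toℕ (lookup (tabulate (blockResidue m)) j) ∎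
        where open ≡-Reasoning
      onto : ∀ r → r < 3 → Σ (Fin 3) λ j → g (m * 3 + suc (toℕ j)) % 3 ≡ r
      onto r r<3 with proj₂ permutes (fromℕ< r<3)
      ... | j , hit = j , trans (residue-mod j) (trans (cong toℕ hit) (toℕ-fromℕ< r<3))
      one-to-one : ∀ j j′ → g (m * 3 + suc (toℕ j)) % 3 ≡ g (m * 3 + suc (toℕ j′)) % 3 → j ≡ j′
      one-to-one j j′ same =
        proj₁ permutes j j′ (toℕ-injective (trans (sym (residue-mod j)) (trans same (residue-mod j′))))

⟨⟩-+ : ∀ {S x y} → ⟨ S ⟩ x → ⟨ S ⟩ y → ⟨ S ⟩ (x + y)
⟨⟩-+ gen-zero y∈ = y∈
⟨⟩-+ {S} {y = y} (gen-step {g} {x} g∈S x∈) y∈ =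
  subst ⟨ S ⟩ (sym (+-assoc g x y)) (gen-step g∈S (⟨⟩-+ x∈ y∈))

⟨⟩-* : ∀ {S g} → g ∈ S → ∀ n → ⟨ S ⟩ (n * g)
⟨⟩-* g∈S zero = gen-zero
⟨⟩-* g∈S (suc n) = gen-step g∈S (⟨⟩-* g∈S n)

⟨⟩-gen : ∀ {S g} → g ∈ S → ⟨ S ⟩ g
⟨⟩-gen {S} {g} g∈S = subst ⟨ S ⟩ (*-identityˡ g) (⟨⟩-* g∈S 1)

even-or-odd : ∀ x → (∃ λ y → x ≡ 2 * y) ⊎ (∃ λ y → x ≡ suc (2 * y))
even-or-odd zero = inj₁ (0 , refl)
even-or-odd (suc x) with even-or-odd x
... | inj₁ (y , refl) = inj₂ (y , refl)
... | inj₂ (y , refl) = inj₁ (suc y , sym (*-suc 2 y))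

-- Ring identities are stated with a and A unfolded: the solver treats defined constants as opaque.
module Semigroup (k : ℕ) where

  a : ℕ
  a = 6 * k + 3

  A : ℕ
  A = 2 + 6 * k

  gens : List ℕ
  gens = a ∷ a + 2 ∷ 2 * a ∸ 2 ∷ []

  G : Pred
  G = ⟨ gens ⟩

  2a∸2≡2A : 2 * a ∸ 2 ≡ 2 * A
  2a∸2≡2A = trans (cong (_∸ 2) (double k)) (m+n∸m≡n 2 (2 * A))
    where
    double : ∀ k → 2 * (6 * k + 3) ≡ 2 + 2 * (2 + 6 * k)
    double = solve-∀

  G-a : G a
  G-a = ⟨⟩-gen (here refl)

  G-a+2 : G (a + 2)
  G-a+2 = ⟨⟩-gen (there (here refl))

  G-2A+ : ∀ {x} → G x → G (2 * A + x)
  G-2A+ {x} x∈ = subst (λ g → G (g + x)) 2a∸2≡2A (gen-step (there (there (here refl))) x∈)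

  combination : ℕ → ℕ → ℕ → ℕ
  combination q r u = q * a + 2 * r + u * (2 * A)

  combination-≡ : ∀ q r u → (q + 2 * u) * a + 2 * r ∸ 2 * u ≡ combination q r u
  combination-≡ q r u = trans (cong (_∸ 2 * u) (expand k q r u)) (m+n∸n≡m (combination q r u) (2 * u))
    where
    expand : ∀ k q r u → (q + 2 * u) * (6 * k + 3) + 2 * r ≡
                         q * (6 * k + 3) + 2 * r + u * (2 * (2 + 6 * k)) + 2 * u
    expand = solve-∀

  G→combination : ∀ {x} → G x → ∃ λ q → ∃ λ r → ∃ λ u → r ≤ q × x ≡ combination q r u
  G→combination gen-zero = 0 , 0 , 0 , z≤n , refl
  G→combination (gen-step (here refl) x∈) with G→combination x∈
  ... | q , r , u , r≤q , refl = suc q , r , u , m≤n⇒m≤1+n r≤q , add-a k q r u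
    where
    add-a : ∀ k q r u → let c = q * (6 * k + 3) + 2 * r + u * (2 * (2 + 6 * k)) in
            6 * k + 3 + c ≡ suc q * (6 * k + 3) + 2 * r + u * (2 * (2 + 6 * k))
    add-a = solve-∀
  G→combination (gen-step (there (here refl)) x∈) with G→combination x∈
  ... | q , r , u , r≤q , refl = suc q , suc r , u , s≤s r≤q , add-a+2 k q r u
    where
    add-a+2 : ∀ k q r u → let c = q * (6 * k + 3) + 2 * r + u * (2 * (2 + 6 * k)) in
              6 * k + 3 + 2 + c ≡ suc q * (6 * k + 3) + 2 * suc r + u * (2 * (2 + 6 * k))
    add-a+2 = solve-∀
  G→combination (gen-step (there (there (here refl))) x∈) with G→combination x∈
  ... | q , r , u , r≤q , refl = q , r , suc u , r≤q , trans (cong (_+ combination q r u) 2a∸2≡2A) (add-2A k q r u)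
    where
    add-2A : ∀ k q r u → let c = q * (6 * k + 3) + 2 * r + u * (2 * (2 + 6 * k)) in
             2 * (2 + 6 * k) + c ≡ q * (6 * k + 3) + 2 * r + suc u * (2 * (2 + 6 * k))
    add-2A = solve-∀

  combination→G : ∀ q r u → r ≤ q → G (combination q r u)
  combination→G q r u r≤q with m≤n⇒∃[o]m+o≡n r≤q
  ... | d , refl = subst G (regroup k d r u) (⟨⟩-+ (⟨⟩-* (here refl) d) (⟨⟩-+ (⟨⟩-* (there (here refl)) r) us))
    where
    us : G (u * (2 * A))
    us = subst G (cong (u *_) 2a∸2≡2A) (⟨⟩-* (there (there (here refl))) u)
    regroup : ∀ k d r u → d * (6 * k + 3) + (r * (6 * k + 3 + 2) + u * (2 * (2 + 6 * k))) ≡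
                          (r + d) * (6 * k + 3) + 2 * r + u * (2 * (2 + 6 * k))
    regroup = solve-∀

  G⇔combination : ∀ x → G x ⇔ (∃ λ q → ∃ λ r → ∃ λ u → r ≤ q × x ≡ (q + 2 * u) * a + 2 * r ∸ 2 * u)
  G⇔combination x = mk⇔
    (λ x∈ → let q , r , u , r≤q , x≡ = G→combination x∈ in q , r , u , r≤q , trans x≡ (sym (combination-≡ q r u)))
    (λ (q , r , u , r≤q , x≡) → subst G (sym (trans x≡ (combination-≡ q r u))) (combination→G q r u r≤q))

  EvenPart : ℕ → Set
  EvenPart y = ∃ λ p → ∃ λ s → s ≤ 3 * p × y ≡ p * A + s

  OddPart : ℕ → Set
  OddPart y = ∃ λ p → ∃ λ s → s ≤ 3 * p + 1 × y ≡ p * A + (3 * k + 1) + s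

  ParityForm : ℕ → Set
  ParityForm x = (∃ λ y → x ≡ 2 * y × EvenPart y) ⊎ (∃ λ y → x ≡ suc (2 * y) × OddPart y)

  parity-form-step : ∀ {g x} → g ∈ gens → ParityForm x → ParityForm (g + x)
  parity-form-step (here refl) (inj₁ (_ , refl , p , s , s≤ , refl)) =
    inj₂ (_ , even+a k p s , p , s , ≤-trans s≤ (m≤m+n (3 * p) 1) , refl)
    where
    even+a : ∀ k p s → 6 * k + 3 + 2 * (p * (2 + 6 * k) + s) ≡ suc (2 * (p * (2 + 6 * k) + (3 * k + 1) + s))
    even+a = solve-∀
  parity-form-step (here refl) (inj₂ (_ , refl , p , s , s≤ , refl)) =
    inj₁ (_ , odd+a k p s , suc p , suc s , ≤-trans (s≤s s≤) (m+o≡n⇒m≤n 1 (bound p)) , refl)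
    where
    odd+a : ∀ k p s → 6 * k + 3 + suc (2 * (p * (2 + 6 * k) + (3 * k + 1) + s)) ≡ 2 * (suc p * (2 + 6 * k) + suc s)
    odd+a = solve-∀
    bound : ∀ p → suc (3 * p + 1) + 1 ≡ 3 * suc p
    bound = solve-∀
  parity-form-step (there (here refl)) (inj₁ (_ , refl , p , s , s≤ , refl)) =
    inj₂ (_ , even+a+2 k p s , p , suc s , subst (suc s ≤_) (+-comm 1 (3 * p)) (s≤s s≤) , refl)
    where
    even+a+2 : ∀ k p s → 6 * k + 3 + 2 + 2 * (p * (2 + 6 * k) + s) ≡ suc (2 * (p * (2 + 6 * k) + (3 * k + 1) + suc s))
    even+a+2 = solve-∀
  parity-form-step (there (here refl)) (inj₂ (_ , refl , p , s , s≤ , refl)) =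
    inj₁ (_ , odd+a+2 k p s , suc p , 2 + s , ≤-trans (+-monoʳ-≤ 2 s≤) (≤-reflexive (bound p)) , refl)
    where
    odd+a+2 : ∀ k p s → 6 * k + 3 + 2 + suc (2 * (p * (2 + 6 * k) + (3 * k + 1) + s)) ≡ 2 * (suc p * (2 + 6 * k) + (2 + s))
    odd+a+2 = solve-∀
    bound : ∀ p → 2 + (3 * p + 1) ≡ 3 * suc p
    bound = solve-∀
  parity-form-step {x = x} (there (there (here refl))) form = subst (λ g → ParityForm (g + x)) (sym 2a∸2≡2A) (add-2A form)
    where
    add-2A : ∀ {x} → ParityForm x → ParityForm (2 * A + x)
    add-2A (inj₁ (_ , refl , p , s , s≤ , refl)) =
      inj₁ (_ , even+2A k p s , suc p , s , ≤-trans s≤ (*-monoʳ-≤ 3 (n≤1+n p)) , refl)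
      where
      even+2A : ∀ k p s → 2 * (2 + 6 * k) + 2 * (p * (2 + 6 * k) + s) ≡ 2 * (suc p * (2 + 6 * k) + s)
      even+2A = solve-∀
    add-2A (inj₂ (_ , refl , p , s , s≤ , refl)) =
      inj₂ (_ , odd+2A k p s , suc p , s , ≤-trans s≤ (+-monoˡ-≤ 1 (*-monoʳ-≤ 3 (n≤1+n p))) , refl)
      where
      odd+2A : ∀ k p s → 2 * (2 + 6 * k) + suc (2 * (p * (2 + 6 * k) + (3 * k + 1) + s)) ≡
                         suc (2 * (suc p * (2 + 6 * k) + (3 * k + 1) + s))
      odd+2A = solve-∀

  G→parity-form : ∀ {x} → G x → ParityForm x
  G→parity-form gen-zero = inj₁ (0 , refl , 0 , 0 , z≤n , refl)
  G→parity-form (gen-step g∈ x∈) = parity-form-step g∈ (G→parity-form x∈)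

  even-part→G : ∀ p s → s ≤ 3 * p → G (2 * (p * A + s))
  odd-part→G : ∀ p s → s ≤ 3 * p + 1 → G (suc (2 * (p * A + (3 * k + 1) + s)))
  even-part→G zero zero _ = gen-zero
  even-part→G (suc p) zero _ = subst G (sym (shift k p)) (G-2A+ (even-part→G p 0 z≤n))
    where
    shift : ∀ k p → 2 * (suc p * (2 + 6 * k) + 0) ≡ 2 * (2 + 6 * k) + 2 * (p * (2 + 6 * k) + 0)
    shift = solve-∀
  even-part→G (suc p) (suc s) s< with s ≤? 3 * p + 1
  ... | yes s≤ = subst G (sym (via-a k p s)) (gen-step (here refl) (odd-part→G p s s≤))
    where
    via-a : ∀ k p s → 2 * (suc p * (2 + 6 * k) + suc s) ≡ 6 * k + 3 + suc (2 * (p * (2 + 6 * k) + (3 * k + 1) + s))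
    via-a = solve-∀
  ... | no s≰ = subst G (sym (via-a+2 k p s s≡)) (gen-step (there (here refl)) (odd-part→G p (3 * p + 1) ≤-refl))
    where
    s≡ : s ≡ suc (3 * p + 1)
    s≡ = ≤-antisym (≤-pred (≤-trans s< (≤-reflexive (triple p)))) (≰⇒> s≰)
      where
      triple : ∀ p → 3 * suc p ≡ suc (suc (3 * p + 1))
      triple = solve-∀
    via-a+2 : ∀ k p s → s ≡ suc (3 * p + 1) →
              2 * (suc p * (2 + 6 * k) + suc s) ≡ 6 * k + 3 + 2 + suc (2 * (p * (2 + 6 * k) + (3 * k + 1) + (3 * p + 1)))
    via-a+2 k p s refl = identity k p
      where
      identity : ∀ k p → 2 * (suc p * (2 + 6 * k) + suc (suc (3 * p + 1))) ≡
                         6 * k + 3 + 2 + suc (2 * (p * (2 + 6 * k) + (3 * k + 1) + (3 * p + 1)))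
      identity = solve-∀
  odd-part→G p zero _ = subst G (sym (via-a k p)) (gen-step (here refl) (even-part→G p 0 z≤n))
    where
    via-a : ∀ k p → suc (2 * (p * (2 + 6 * k) + (3 * k + 1) + 0)) ≡ 6 * k + 3 + 2 * (p * (2 + 6 * k) + 0)
    via-a = solve-∀
  odd-part→G p (suc s) s< = subst G (sym (via-a+2 k p s)) (gen-step (there (here refl)) (even-part→G p s s≤))
    where
    via-a+2 : ∀ k p s → suc (2 * (p * (2 + 6 * k) + (3 * k + 1) + suc s)) ≡ 6 * k + 3 + 2 + 2 * (p * (2 + 6 * k) + s)
    via-a+2 = solve-∀
    s≤ : s ≤ 3 * p
    s≤ = ≤-pred (subst (suc s ≤_) (+-comm (3 * p) 1) s<)

  -- The first alternative is the overflow of the odd stretch of block p − 1 into block p.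
  OddAt : ℕ → ℕ → Set
  OddAt p z = z + (3 * k + 3) ≤ 3 * p ⊎ (3 * k + 1 ≤ z × z ≤ 3 * k + 3 * p + 2)

  oddAt? : ∀ p z → Dec (OddAt p z)
  oddAt? p z = z + (3 * k + 3) ≤? 3 * p ⊎-dec (3 * k + 1 ≤? z ×-dec z ≤? 3 * k + 3 * p + 2)

  evenIn : ℕ → Bool
  evenIn y = does (y % A ≤? 3 * (y / A))

  oddIn : ℕ → Bool
  oddIn y = does (oddAt? (y / A) (y % A))

  bitsAt : ℕ → ℕ → Bool × Bool
  bitsAt p z = does (z ≤? 3 * p) , does (oddAt? p z)

  division : ∀ y → y ≡ y / A * A + y % A
  division y = trans (m≡m%n+[m/n]*n y A) (+-comm (y % A) _)

  block-coordinates : ∀ p z → z < A → (p * A + z) / A ≡ p × (p * A + z) % A ≡ z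
  block-coordinates p z z<A = quotient , remainder
    where
    open ≡-Reasoning
    remainder : (p * A + z) % A ≡ z
    remainder = begin
      (p * A + z) % A ≡⟨ cong (_% A) (+-comm (p * A) z) ⟩
      (z + p * A) % A ≡⟨ [m+kn]%n≡m%n z p A ⟩
      z % A           ≡⟨ m<n⇒m%n≡m z<A ⟩
      z               ∎
    fits : (p * A) % A + z % A < A
    fits = subst (_< A) (sym (cong₂ _+_ (m*n%n≡0 p A) (m<n⇒m%n≡m z<A))) z<A
    quotient : (p * A + z) / A ≡ p
    quotient = begin
      (p * A + z) / A   ≡⟨ +-distrib-/ (p * A) z fits ⟩
      p * A / A + z / A ≡⟨ cong₂ _+_ (m*n/n≡m p A) (m<n⇒m/n≡0 z<A) ⟩
      p + 0             ≡⟨ +-identityʳ p ⟩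
      p                 ∎

  bits-in-block : ∀ p z → z < A → (evenIn (p * A + z) , oddIn (p * A + z)) ≡ bitsAt p z
  bits-in-block p z z<A with block-coordinates p z z<A
  ... | quotient , remainder rewrite quotient | remainder = refl

  full-block : ∀ p z → 2 * k + 1 ≤ p → z < A → z ≤ 3 * p × OddAt p z
  full-block p z p≥ z<A = <⇒≤ (<-trans z<A A<3p) , odd
    where
    3[2k+1]≤3p : 3 * (2 * k + 1) ≤ 3 * p
    3[2k+1]≤3p = *-monoʳ-≤ 3 p≥
    A<3p : A < 3 * p
    A<3p = ≤-trans (≤-reflexive (A+1 k)) 3[2k+1]≤3p
      where
      A+1 : ∀ k → suc (2 + 6 * k) ≡ 3 * (2 * k + 1)
      A+1 = solve-∀
    odd : OddAt p z
    odd with z <? 3 * k + 1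
    ... | yes z< = inj₁ (≤-trans (+-monoˡ-≤ (3 * k + 3) (m<n+1⇒m≤n (3 * k) z<)) (≤-trans (≤-reflexive (double k)) 3[2k+1]≤3p))
      where
      double : ∀ k → 3 * k + (3 * k + 3) ≡ 3 * (2 * k + 1)
      double = solve-∀
    ... | no z≮ = inj₂ (≮⇒≥ z≮ , ≤-trans (<⇒≤ (<-trans z<A A<3p)) (≤-trans (m≤n+m (3 * p) (3 * k)) (m≤m+n _ 2)))

  beyond-full : ∀ y → (2 * k + 1) * A ≤ y → evenIn y ≡ true × oddIn y ≡ true
  beyond-full y y≥ = dec-true (y % A ≤? 3 * (y / A)) (proj₁ full) , dec-true (oddAt? (y / A) (y % A)) (proj₂ full)
    where
    full : y % A ≤ 3 * (y / A) × OddAt (y / A) (y % A)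
    full = full-block (y / A) (y % A) (subst (_≤ y / A) (m*n/n≡m (2 * k + 1) A) (/-monoˡ-≤ A y≥)) (m%n<n y A)

  small-block : ∀ {p} → ¬ (2 * k + 1 ≤ p) → 3 * p ≤ 6 * k
  small-block {p} p≱ = ≤-trans (*-monoʳ-≤ 3 (m<n+1⇒m≤n (2 * k) (≰⇒> p≱))) (≤-reflexive (sym (*-assoc 3 2 k)))

  evenIn→even-part : ∀ y → evenIn y ≡ true → EvenPart y
  evenIn→even-part y member = y / A , y % A , dec-true⁻¹ (y % A ≤? 3 * (y / A)) member , division y

  even-part→evenIn : ∀ y → EvenPart y → evenIn y ≡ true
  even-part→evenIn _ (p , s , s≤ , refl) with 2 * k + 1 ≤? p
  ... | yes p≥ = proj₁ (beyond-full _ (≤-trans (*-monoˡ-≤ A p≥) (m≤m+n (p * A) s)))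
  ... | no p≱ = trans (cong proj₁ (bits-in-block p s s<A)) (dec-true (s ≤? 3 * p) s≤)
    where
    s<A : s < A
    s<A = s≤s (m≤n⇒m≤1+n (≤-trans s≤ (small-block p≱)))

  oddIn→odd-part : ∀ y → oddIn y ≡ true → OddPart y
  oddIn→odd-part y member = from-block (y / A) (y % A) (dec-true⁻¹ (oddAt? (y / A) (y % A)) member) (division y)
    where
    from-block : ∀ P z → OddAt P z → y ≡ P * A + z → OddPart y
    from-block P z (inj₂ (lo , hi)) y≡ with m≤n⇒∃[o]m+o≡n lo
    ... | s , refl = P , s , +-cancelˡ-≤ (3 * k + 1) s (3 * P + 1) (≤-trans hi (≤-reflexive (regroup k P))) ,
                     trans y≡ (sym (+-assoc (P * A) (3 * k + 1) s))
      where
      regroup : ∀ k P → 3 * k + 3 * P + 2 ≡ 3 * k + 1 + (3 * P + 1)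
      regroup = solve-∀
    from-block zero z (inj₁ le) _ = contradiction (≤-trans (m≤n+m 3 (3 * k)) (≤-trans (m≤n+m _ z) le)) λ ()
    from-block (suc P) z (inj₁ le) y≡ =
      P , 3 * k + 1 + z , +-cancelʳ-≤ 2 _ _ (≤-trans (≤-reflexive (shift k z)) (≤-trans le (≤-reflexive (triple P)))) ,
      trans y≡ (overflow k P z)
      where
      shift : ∀ k z → 3 * k + 1 + z + 2 ≡ z + (3 * k + 3)
      shift = solve-∀
      triple : ∀ P → 3 * suc P ≡ 3 * P + 1 + 2
      triple = solve-∀
      overflow : ∀ k P z → suc P * (2 + 6 * k) + z ≡ P * (2 + 6 * k) + (3 * k + 1) + (3 * k + 1 + z)
      overflow = solve-∀

  odd-overflow : ∀ {p s v} → ¬ (2 * k + 1 ≤ p) → s ≤ 3 * p + 1 → A + v ≡ 3 * k + 1 + s →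
                 v < A × v + (3 * k + 3) ≤ 3 * suc p
  odd-overflow {p} {s} {v} p≱ s≤ A+v≡ = v<A , v-bound
    where
    v+ : v + (3 * k + 3) ≡ s + 2
    v+ = +-cancelˡ-≡ (3 * k + 1) _ _ (trans (regroup k v) (trans (cong (_+ 2) A+v≡) (+-assoc (3 * k + 1) s 2)))
      where
      regroup : ∀ k v → 3 * k + 1 + (v + (3 * k + 3)) ≡ 2 + 6 * k + v + 2
      regroup = solve-∀
    v-bound : v + (3 * k + 3) ≤ 3 * suc p
    v-bound = ≤-trans (≤-reflexive v+) (≤-trans (+-monoˡ-≤ 2 s≤) (≤-reflexive (triple p)))
      where
      triple : ∀ p → 3 * p + 1 + 2 ≡ 3 * suc p
      triple = solve-∀
    v≤3k : v ≤ 3 * k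
    v≤3k = +-cancelʳ-≤ (3 * k + 3) v (3 * k)
      (≤-trans v-bound (≤-trans (*-monoʳ-≤ 3 (s≤s (m<n+1⇒m≤n (2 * k) (≰⇒> p≱)))) (≤-reflexive (triple k))))
      where
      triple : ∀ k → 3 * suc (2 * k) ≡ 3 * k + (3 * k + 3)
      triple = solve-∀
    v<A : v < A
    v<A = s≤s (≤-trans v≤3k (m+o≡n⇒m≤n (3 * k + 1) (double k)))
      where
      double : ∀ k → 3 * k + (3 * k + 1) ≡ suc (6 * k)
      double = solve-∀

  odd-part→oddIn : ∀ y → OddPart y → oddIn y ≡ true
  odd-part→oddIn _ (p , s , s≤ , refl) with 2 * k + 1 ≤? p
  ... | yes p≥ = proj₂ (beyond-full _ (≤-trans (*-monoˡ-≤ A p≥) (≤-trans (m≤m+n (p * A) _) (m≤m+n _ s))))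
  ... | no p≱ with 3 * k + 1 + s <? A
  ...   | yes w<A = begin
    oddIn (p * A + (3 * k + 1) + s)   ≡⟨ cong oddIn (+-assoc (p * A) (3 * k + 1) s) ⟩
    oddIn (p * A + (3 * k + 1 + s))   ≡⟨ cong proj₂ (bits-in-block p (3 * k + 1 + s) w<A) ⟩
    does (oddAt? p (3 * k + 1 + s))   ≡⟨ dec-true (oddAt? p (3 * k + 1 + s)) (inj₂ (m≤m+n _ s , w≤)) ⟩
    true                              ∎
    where
    open ≡-Reasoning
    w≤ : 3 * k + 1 + s ≤ 3 * k + 3 * p + 2
    w≤ = ≤-trans (+-monoʳ-≤ (3 * k + 1) s≤) (≤-reflexive (regroup k p))
      where
      regroup : ∀ k p → 3 * k + 1 + (3 * p + 1) ≡ 3 * k + 3 * p + 2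
      regroup = solve-∀
  ...   | no w≮A with m≤n⇒∃[o]m+o≡n (≮⇒≥ w≮A)
  ...     | v , A+v≡ with odd-overflow p≱ s≤ A+v≡
  ...       | v<A , v-bound = begin
    oddIn (p * A + (3 * k + 1) + s)   ≡⟨ cong oddIn y≡ ⟩
    oddIn (suc p * A + v)             ≡⟨ cong proj₂ (bits-in-block (suc p) v v<A) ⟩
    does (oddAt? (suc p) v)           ≡⟨ dec-true (oddAt? (suc p) v) (inj₁ v-bound) ⟩
    true                              ∎
    where
    open ≡-Reasoning
    y≡ : p * A + (3 * k + 1) + s ≡ suc p * A + v
    y≡ = begin
      p * A + (3 * k + 1) + s ≡⟨ +-assoc (p * A) _ s ⟩
      p * A + (3 * k + 1 + s) ≡⟨ cong (p * A +_) A+v≡ ⟨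
      p * A + (A + v)         ≡⟨ +-assoc (p * A) A v ⟨
      p * A + A + v           ≡⟨ cong (_+ v) (+-comm (p * A) A) ⟩
      suc p * A + v           ∎

  open Scan evenIn oddIn

  G→member : ∀ {x} → G x → member x ≡ true
  G→member x∈ with G→parity-form x∈
  ... | inj₁ (y , refl , even) = trans (interleave-even evenIn oddIn y) (even-part→evenIn y even)
  ... | inj₂ (y , refl , odd) = trans (interleave-odd evenIn oddIn y) (odd-part→oddIn y odd)

  member→G : ∀ x → member x ≡ true → G x
  member→G x x∈ with even-or-odd x
  ... | inj₁ (y , refl) with evenIn→even-part y (trans (sym (interleave-even evenIn oddIn y)) x∈)
  ...   | p , s , s≤ , refl = even-part→G p s s≤
  member→G x x∈ | inj₂ (y , refl) with oddIn→odd-part y (trans (sym (interleave-odd evenIn oddIn y)) x∈)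
  ...   | p , s , s≤ , refl = odd-part→G p s s≤

  BlockPattern : ℕ → ℕ → List Segment → Set
  BlockPattern p lo [] = ⊤
  BlockPattern p lo (segment bits q r ∷ ss) =
    (∀ z → lo ≤ z → z < lo + (3 * q + r) → bitsAt p z ≡ bits) × BlockPattern p (lo + (3 * q + r)) ss

  pattern→matches : ∀ p lo ss → lo + totalLength ss ≤ A → BlockPattern p lo ss → Matches (p * A + lo) ss
  pattern→matches p lo [] _ _ = tt
  pattern→matches p lo (segment bits q r ∷ ss) fits (constant , rest) =
    stretch , subst (λ y → Matches y ss) (sym (+-assoc (p * A) lo L))
                    (pattern→matches p (lo + L) ss (subst (_≤ A) (sym (+-assoc lo L _)) fits) rest)
    where
    L : ℕ
    L = 3 * q + r
    stretch : ∀ j → j < L → (evenIn (p * A + lo + j) , oddIn (p * A + lo + j)) ≡ bits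
    stretch j j<L = begin
      (evenIn (p * A + lo + j) , oddIn (p * A + lo + j))     ≡⟨ cong (λ y → evenIn y , oddIn y) (+-assoc (p * A) lo j) ⟩
      (evenIn (p * A + (lo + j)) , oddIn (p * A + (lo + j))) ≡⟨ bits-in-block p (lo + j) (<-≤-trans within in-block) ⟩
      bitsAt p (lo + j)                                     ≡⟨ constant (lo + j) (m≤m+n lo j) within ⟩
      bits                                                  ∎
      where
      open ≡-Reasoning
      within : lo + j < lo + L
      within = +-monoʳ-< lo j<L
      in-block : lo + L ≤ A
      in-block = ≤-trans (+-monoʳ-≤ lo (m≤m+n L (totalLength ss))) fits

  block-step : ∀ p ss {c c′} → totalLength ss ≡ A → BlockPattern p 0 ss →
               config (p * A) ≡ c → run c ss ≡ just c′ → config (suc p * A) ≡ c′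
  block-step p ss length≡ layout start ran =
    trans (cong config (trans (+-comm A (p * A)) (cong (p * A +_) (sym length≡))))
          (config-run ss (p * A) matches (trans (cong (λ c → run c ss) start) ran))
    where
    matches : Matches (p * A) ss
    matches = subst (λ y → Matches y ss) (+-identityʳ (p * A)) (pattern→matches p 0 ss (≤-reflexive length≡) layout)

  odd-false : ∀ p z → 3 * p < z + (3 * k + 3) → ¬ (3 * k + 1 ≤ z × z ≤ 3 * k + 3 * p + 2) → does (oddAt? p z) ≡ false
  odd-false p z no-overflow not-inner =
    dec-false (oddAt? p z) λ { (inj₁ overflow) → <⇒≱ no-overflow overflow ; (inj₂ inner) → not-inner inner }

  early : Fin 3 → Config
  early ρ = ρ , just (allBut ρ)

  earlySegments : ℕ → ℕ → List Segment
  earlySegments p e =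
    segment (true , false) p 1 ∷ segment (false , false) (suc e) 0 ∷
    segment (false , true) p 2 ∷ segment (false , false) e 2 ∷ []

  run-early : ∀ ρ p e → run (early ρ) (earlySegments p e) ≡ just (early (rotate ρ))
  run-early 0₃ p e = refl
  run-early 1₃ p e = refl
  run-early 2₃ p e = refl

  early-pattern : ∀ p e → suc p + e ≡ k → BlockPattern p 0 (earlySegments p e)
  early-pattern p e k≡ =
    (λ z _ z< → cong₂ _,_ (dec-true (z ≤? 3 * p) (m<n+1⇒m≤n (3 * p) z<))
                          (odd-false p z (no-overflow z) λ (lo , _) → <⇒≱ (<-≤-trans z< (≤-trans (m≤m+n L₁ L₂) (≤-reflexive lo₃))) lo)) ,
    (λ z lo≤ z< → cong₂ _,_ (dec-false (z ≤? 3 * p) (<⇒≱ (<-≤-trans 3p<L₁ lo≤)))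
                            (odd-false p z (no-overflow z) λ (lo , _) → <⇒≱ (<-≤-trans z< (≤-reflexive lo₃)) lo)) ,
    (λ z lo≤ z< → cong₂ _,_ (dec-false (z ≤? 3 * p) (<⇒≱ (<-≤-trans 3p<L₁ (≤-trans (m≤m+n L₁ L₂) lo≤))))
                            (dec-true (oddAt? p z) (inj₂ (subst (_≤ z) lo₃ lo≤ , ≤-pred (<-≤-trans z< (≤-reflexive lo₄)))))) ,
    (λ z lo≤ z< → cong₂ _,_ (dec-false (z ≤? 3 * p) (<⇒≱ (<-≤-trans 3p<L₁ (≤-trans (m≤m+n L₁ L₂) (≤-trans (m≤m+n _ L₃) lo≤)))))
                            (odd-false p z (no-overflow z) λ (_ , hi) → <⇒≱ (<-≤-trans (≤-reflexive (sym lo₄)) lo≤) hi)) ,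
    tt
    where
    on-k : (P : ℕ → Set) → P (suc p + e) → P k
    on-k P = subst P k≡
    L₁ L₂ L₃ : ℕ
    L₁ = 3 * p + 1
    L₂ = 3 * suc e + 0
    L₃ = 3 * p + 2
    b₃ : ∀ p e → 3 * p + 1 + (3 * suc e + 0) ≡ 3 * (suc p + e) + 1
    b₃ = solve-∀
    b₄ : ∀ p e → 3 * p + 1 + (3 * suc e + 0) + (3 * p + 2) ≡ suc (3 * (suc p + e) + 3 * p + 2)
    b₄ = solve-∀
    below : ∀ p e → suc (3 * p) + (3 * e + 5) ≡ 3 * (suc p + e) + 3
    below = solve-∀
    lo₃ : L₁ + L₂ ≡ 3 * k + 1
    lo₃ = on-k (λ k → L₁ + L₂ ≡ 3 * k + 1) (b₃ p e)
    lo₄ : L₁ + L₂ + L₃ ≡ suc (3 * k + 3 * p + 2)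
    lo₄ = on-k (λ k → L₁ + L₂ + L₃ ≡ suc (3 * k + 3 * p + 2)) (b₄ p e)
    no-overflow : ∀ z → 3 * p < z + (3 * k + 3)
    no-overflow z = <-≤-trans (m+o≡n⇒m≤n (3 * e + 5) below′) (m≤n+m _ z)
      where
      below′ : suc (3 * p) + (3 * e + 5) ≡ 3 * k + 3
      below′ = on-k (λ k → suc (3 * p) + (3 * e + 5) ≡ 3 * k + 3) (below p e)
    3p<L₁ : 3 * p < L₁
    3p<L₁ = ≤-reflexive (+-comm 1 (3 * p))

  early-block : ∀ p e → suc p + e ≡ k → config (p * A) ≡ early (residue p) →
                config (suc p * A) ≡ early (residue (suc p))
  early-block p e k≡ start =
    block-step p (earlySegments p e) (subst (λ k → totalLength (earlySegments p e) ≡ 2 + 6 * k) k≡ (total p e))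
      (early-pattern p e k≡) start (run-early (residue p) p e)
    where
    total : ∀ p e → 3 * p + 1 + (3 * suc e + 0 + (3 * p + 2 + (3 * e + 2 + 0))) ≡ 2 + 6 * (suc p + e)
    total = solve-∀

  mid : Fin 3 → Config
  mid ρ = ρ , just ⁅ rotate (rotate ρ) ⁆

  turnSegments : List Segment
  turnSegments = segment (true , false) k 1 ∷ segment (false , true) k 1 ∷ []

  run-turn : ∀ ρ → run (early ρ) turnSegments ≡ just (mid (rotate ρ))
  run-turn 0₃ = refl
  run-turn 1₃ = refl
  run-turn 2₃ = refl

  turn-pattern : BlockPattern k 0 turnSegments
  turn-pattern =
    (λ z _ z< → cong₂ _,_ (dec-true (z ≤? 3 * k) (m<n+1⇒m≤n (3 * k) z<))
                          (odd-false k z (<-≤-trans (m<m+n (3 * k) (s≤s z≤n)) (m≤n+m _ z)) λ (lo , _) → <⇒≱ z< lo)) ,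
    (λ z lo≤ z< → cong₂ _,_ (dec-false (z ≤? 3 * k) (<⇒≱ (<-≤-trans (≤-reflexive (+-comm 1 (3 * k))) lo≤)))
                            (dec-true (oddAt? k z) (inj₂ (lo≤ , ≤-pred (<-≤-trans z< (m+o≡n⇒m≤n 1 (upper k))))))) ,
    tt
    where
    upper : ∀ k → 3 * k + 1 + (3 * k + 1) + 1 ≡ suc (3 * k + 3 * k + 2)
    upper = solve-∀

  turn-block : config (k * A) ≡ early (residue k) → config (suc k * A) ≡ mid (residue (suc k))
  turn-block start = block-step k turnSegments (total k) turn-pattern start (run-turn (residue k))
    where
    total : ∀ k → 3 * k + 1 + (3 * k + 1 + 0) ≡ 2 + 6 * k
    total = solve-∀

  midSegments : ℕ → ℕ → List Segment
  midSegments d e =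
    segment (true , true) d 1 ∷ segment (true , false) (suc e) 0 ∷
    segment (true , true) (suc d) 0 ∷ segment (false , true) e 1 ∷ []

  run-mid : ∀ ρ d e → run (mid ρ) (midSegments d e) ≡ just (mid (rotate ρ))
  run-mid 0₃ d e = refl
  run-mid 1₃ d e = refl
  run-mid 2₃ d e = refl

  mid-pattern : ∀ d e → suc d + e ≡ k → BlockPattern (suc k + d) 0 (midSegments d e)
  mid-pattern d e k≡ =
    (λ z _ z< → let z≤ = m<n+1⇒m≤n (3 * d) z< in
      cong₂ _,_ (dec-true (z ≤? 3 * p) (≤-trans z≤ (m+o≡n⇒m≤n (3 * k + 3) (edge k d))))
                (dec-true (oddAt? p z) (inj₁ (≤-trans (+-monoˡ-≤ (3 * k + 3) z≤) (≤-reflexive (edge k d)))))) ,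
    (λ z lo≤ z< → let z<3k+1 = <-≤-trans z< (≤-reflexive lo₃) in
      cong₂ _,_ (dec-true (z ≤? 3 * p) (≤-trans (<⇒≤ z<3k+1) 3k+1≤3p))
                (odd-false p z (subst (_< z + (3 * k + 3)) (edge k d) (+-monoˡ-< (3 * k + 3) (subst (_≤ z) (+-comm (3 * d) 1) lo≤)))
                               λ (lo , _) → <⇒≱ z<3k+1 lo)) ,
    (λ z lo≤ z< → let z≤ = ≤-pred (<-≤-trans z< (≤-reflexive lo₄)) in
      cong₂ _,_ (dec-true (z ≤? 3 * p) z≤)
                (dec-true (oddAt? p z) (inj₂ (subst (_≤ z) lo₃ lo≤ , ≤-trans z≤ (≤-trans (m≤n+m (3 * p) (3 * k)) (m≤m+n _ 2)))))) ,
    (λ z lo≤ z< → let 3p<z = subst (_≤ z) lo₄ lo≤ in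
      cong₂ _,_ (dec-false (z ≤? 3 * p) (<⇒≱ 3p<z))
                (dec-true (oddAt? p z) (inj₂ (≤-trans 3k+1≤3p (<⇒≤ 3p<z) ,
                  ≤-pred (<-≤-trans (<-≤-trans z< (≤-reflexive end)) (m+o≡n⇒m≤n (3 * d + 4) (A-below k d))))))) ,
    tt
    where
    p : ℕ
    p = suc k + d
    on-k : (P : ℕ → Set) → P (suc d + e) → P k
    on-k P = subst P k≡
    L₁ L₂ L₃ L₄ : ℕ
    L₁ = 3 * d + 1
    L₂ = 3 * suc e + 0
    L₃ = 3 * suc d + 0
    L₄ = 3 * e + 1
    b₃ : ∀ d e → 3 * d + 1 + (3 * suc e + 0) ≡ 3 * (suc d + e) + 1
    b₃ = solve-∀
    b₄ : ∀ d e → 3 * d + 1 + (3 * suc e + 0) + (3 * suc d + 0) ≡ suc (3 * (suc (suc d + e) + d))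
    b₄ = solve-∀
    b₅ : ∀ d e → 3 * d + 1 + (3 * suc e + 0) + (3 * suc d + 0) + (3 * e + 1) ≡ 2 + 6 * (suc d + e)
    b₅ = solve-∀
    edge : ∀ k d → 3 * d + (3 * k + 3) ≡ 3 * (suc k + d)
    edge = solve-∀
    A-below : ∀ k d → 2 + 6 * k + (3 * d + 4) ≡ suc (3 * k + 3 * (suc k + d) + 2)
    A-below = solve-∀
    3k+1≤3p : 3 * k + 1 ≤ 3 * p
    3k+1≤3p = m+o≡n⇒m≤n (3 * d + 2) (gap k d)
      where
      gap : ∀ k d → 3 * k + 1 + (3 * d + 2) ≡ 3 * (suc k + d)
      gap = solve-∀
    lo₃ : L₁ + L₂ ≡ 3 * k + 1
    lo₃ = on-k (λ k → L₁ + L₂ ≡ 3 * k + 1) (b₃ d e)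
    lo₄ : L₁ + L₂ + L₃ ≡ suc (3 * p)
    lo₄ = on-k (λ k → L₁ + L₂ + L₃ ≡ suc (3 * (suc k + d))) (b₄ d e)
    end : L₁ + L₂ + L₃ + L₄ ≡ A
    end = on-k (λ k → L₁ + L₂ + L₃ + L₄ ≡ 2 + 6 * k) (b₅ d e)

  mid-block : ∀ d e → suc d + e ≡ k → config ((suc k + d) * A) ≡ mid (residue (suc k + d)) →
              config (suc (suc k + d) * A) ≡ mid (residue (suc (suc k + d)))
  mid-block d e k≡ start =
    block-step (suc k + d) (midSegments d e) (subst (λ k → totalLength (midSegments d e) ≡ 2 + 6 * k) k≡ (total d e))
      (mid-pattern d e k≡) start (run-mid (residue (suc k + d)) d e)
    where
    total : ∀ d e → 3 * d + 1 + (3 * suc e + 0 + (3 * suc d + 0 + (3 * e + 1 + 0))) ≡ 2 + 6 * (suc d + e)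
    total = solve-∀

  early-invariant : ∀ p → p ≤ k → config (p * A) ≡ early (residue p)
  early-invariant zero _ = refl
  early-invariant (suc p) p<k with m≤n⇒∃[o]m+o≡n p<k
  ... | e , k≡ = early-block p e k≡ (early-invariant p (<⇒≤ p<k))

  mid-invariant : ∀ d → d ≤ k → config ((suc k + d) * A) ≡ mid (residue (suc k + d))
  mid-invariant zero _ = subst (λ p → config (p * A) ≡ mid (residue p)) (sym (+-identityʳ (suc k)))
                               (turn-block (early-invariant k ≤-refl))
  mid-invariant (suc d) d<k with m≤n⇒∃[o]m+o≡n d<k
  ... | e , k≡ = subst (λ p → config (p * A) ≡ mid (residue p)) (sym (+-suc (suc k) d))
                       (mid-block d e k≡ (mid-invariant d (<⇒≤ d<k)))

  y₀ : ℕ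
  y₀ = (2 * k + 1) * A

  full-start : config y₀ ≡ mid (residue (suc k + k))
  full-start = trans (cong (λ p → config (p * A)) (sym (2k+1 k))) (mid-invariant k ≤-refl)
    where
    2k+1 : ∀ k → suc k + k ≡ 2 * k + 1
    2k+1 = solve-∀

  mid-periodic : ∀ ρ → iterate (pairStep (true , true)) 3 (mid ρ) ≡ mid ρ
  mid-periodic 0₃ = refl
  mid-periodic 1₃ = refl
  mid-periodic 2₃ = refl

  full-periodic : ∀ q → config (y₀ + (3 * q + 0)) ≡ config y₀
  full-periodic q = begin
    config (y₀ + (3 * q + 0))                             ≡⟨ config-constant (true , true) (3 * q + 0) y₀ all-members ⟩
    iterate (pairStep (true , true)) (3 * q + 0) (config y₀) ≡⟨ iterate-periodic (pairStep (true , true)) 3 periodic q 0 ⟩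
    config y₀                                             ∎
    where
    open ≡-Reasoning
    all-members : ∀ j → j < 3 * q + 0 → (evenIn (y₀ + j) , oddIn (y₀ + j)) ≡ (true , true)
    all-members j _ = let even , odd = beyond-full (y₀ + j) (m≤m+n y₀ j) in cong₂ _,_ even odd
    periodic : iterate (pairStep (true , true)) 3 (config y₀) ≡ config y₀
    periodic = trans (cong (iterate (pairStep (true , true)) 3) full-start) (trans (mid-periodic _) (sym full-start))

  scan-succeeds : ∀ x → scan x ≢ nothing
  scan-succeeds = scan-never-fails λ n →
    2 * (y₀ + (3 * n + 0)) , n≤ n ,
    λ fail → contradiction (trans (sym (cong proj₂ (trans (full-periodic n) full-start))) fail) λ ()
    where
    n≤ : ∀ n → n ≤ 2 * (y₀ + (3 * n + 0))
    n≤ n = ≤-trans (m≤n*m n 3) (≤-trans (m≤m+n (3 * n) 0) (≤-trans (m≤n+m (3 * n + 0) y₀) (m≤n*m _ 2)))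

  beyond-conductor : ∀ x → 2 * y₀ ≤ x → G x
  beyond-conductor x x≥ with even-or-odd x
  ... | inj₁ (y , refl) =
    member→G (2 * y) (trans (interleave-even evenIn oddIn y) (proj₁ (beyond-full y (*-cancelˡ-≤ 2 x≥))))
  ... | inj₂ (y , refl) =
    member→G (suc (2 * y)) (trans (interleave-odd evenIn oddIn y) (proj₂ (beyond-full y y≥)))
    where
    y≥ : y₀ ≤ y
    y≥ = ≮⇒≥ λ y<y₀ → <⇒≱ (subst (_≤ 2 * y₀) (*-suc 2 y) (*-monoʳ-≤ 2 y<y₀)) x≥

  is-numerical-semigroup : IsNumericalSemigroup G
  is-numerical-semigroup = gen-zero , (λ _ _ → ⟨⟩-+) , 2 * y₀ , beyond-conductor

  small-elements : ∀ {x} → G x → x < 2 * A → x ≡ 0 ⊎ x ≡ a ⊎ x ≡ a + 2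
  small-elements x∈ x< with G→combination x∈
  ... | q , r , suc u , _ , refl =
    contradiction (≤-trans (m≤m+n (2 * A) (u * (2 * A))) (m≤n+m (suc u * (2 * A)) (q * a + 2 * r))) (<⇒≱ x<)
  ... | 0 , 0 , 0 , _ , refl = inj₁ refl
  ... | 1 , 0 , 0 , _ , refl = inj₂ (inj₁ (one-a k))
    where
    one-a : ∀ k → 1 * (6 * k + 3) + 2 * 0 + 0 * (2 * (2 + 6 * k)) ≡ 6 * k + 3
    one-a = solve-∀
  ... | 1 , 1 , 0 , _ , refl = inj₂ (inj₂ (one-a+2 k))
    where
    one-a+2 : ∀ k → 1 * (6 * k + 3) + 2 * 1 + 0 * (2 * (2 + 6 * k)) ≡ 6 * k + 3 + 2
    one-a+2 = solve-∀
  ... | 1 , suc (suc r) , 0 , s≤s () , refl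
  ... | suc (suc q) , r , 0 , _ , refl =
    contradiction (≤-trans (m+o≡n⇒m≤n 2 (2A+2 k)) 2a≤x) (<⇒≱ x<)
    where
    2a≤x : 2 * a ≤ suc (suc q) * a + 2 * r + 0 * (2 * A)
    2a≤x = ≤-trans (*-monoˡ-≤ a {2} {suc (suc q)} (s≤s (s≤s z≤n)))
                   (≤-trans (m≤m+n (suc (suc q) * a) (2 * r)) (m≤m+n (suc (suc q) * a + 2 * r) 0))
    2A+2 : ∀ k → 2 * (2 + 6 * k) + 2 ≡ 2 * (6 * k + 3)
    2A+2 = solve-∀

  not-member : ∀ z → ¬ G z → member z ≡ false
  not-member z z∉ with member z in z∈
  ... | true = contradiction (member→G z z∈) z∉
  ... | false = refl

  no-member-between : ∀ {lo hi} → hi ≤ 2 * A → (∀ z → lo ≤ z → z < hi → ¬ (z ≡ 0 ⊎ z ≡ a ⊎ z ≡ a + 2)) →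
                      ∀ z → lo ≤ z → z < hi → member z ≡ false
  no-member-between hi≤ not-small z lo≤ z< = not-member z λ z∈ → not-small z lo≤ z< (small-elements z∈ (<-≤-trans z< hi≤))


  module _ (1≤k : 1 ≤ k) where

    1≤a : 1 ≤ a
    1≤a = ≤-trans (s≤s z≤n) (m≤n+m 3 (6 * k))

    a+2<2A : a + 2 < 2 * A
    a+2<2A with m≤n⇒∃[o]m+o≡n 1≤k
    ... | k′ , k≡ = subst (λ k → 6 * k + 3 + 2 < 2 * (2 + 6 * k)) k≡ (m+o≡n⇒m≤n (6 * k′ + 4) (gap k′))
      where
      gap : ∀ k′ → suc (6 * suc k′ + 3 + 2) + (6 * k′ + 4) ≡ 2 * (2 + 6 * suc k′)
      gap = solve-∀

    open Enumeration member (G→member gen-zero) a 1≤a (λ x x∈ → G→member (gen-step (here refl) (member→G x x∈)))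

    enum-1 : enum 1 ≡ a
    enum-1 = first-unique (enum-next 0) record
      { is-member = G→member G-a
      ; from = 1≤a
      ; first = no-member-between (<⇒≤ (<-trans (m<m+n a (s≤s z≤n)) a+2<2A)) λ
          { _ () _ (inj₁ refl)
          ; _ _ z<a (inj₂ (inj₁ refl)) → <-irrefl refl z<a
          ; _ _ z<a (inj₂ (inj₂ refl)) → <⇒≱ z<a (m≤m+n a 2) }
      }

    enum-2 : enum 2 ≡ a + 2
    enum-2 = first-unique (subst (λ y → FirstMemberFrom member (suc y) (enum 2)) enum-1 (enum-next 1)) record
      { is-member = G→member G-a+2
      ; from = subst (_≤ a + 2) (+-comm a 1) (+-monoʳ-≤ a (s≤s z≤n))
      ; first = no-member-between (<⇒≤ a+2<2A) λ
          { _ () _ (inj₁ refl)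
          ; _ a<a _ (inj₂ (inj₁ refl)) → <-irrefl refl a<a
          ; _ _ z< (inj₂ (inj₂ refl)) → <-irrefl refl z< }
      }

    enum-3 : enum 3 ≡ 2 * a ∸ 2
    enum-3 = trans (first-unique (subst (λ y → FirstMemberFrom member (suc y) (enum 3)) enum-2 (enum-next 2))
      record
      { is-member = G→member (subst G (+-identityʳ (2 * A)) (G-2A+ gen-zero))
      ; from = a+2<2A
      ; first = no-member-between ≤-refl λ
          { _ () _ (inj₁ refl)
          ; _ a+2<a _ (inj₂ (inj₁ refl)) → <⇒≱ a+2<a (m≤m+n a 2)
          ; _ a+2<a+2 _ (inj₂ (inj₂ refl)) → <-irrefl refl a+2<a+2 }
      }) (sym 2a∸2≡2A)

    is-permutation : IsPermutationNS 3 G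
    is-permutation = is-numerical-semigroup , enum , enum-nth G member→G (λ _ → G→member) , generators ,
                     Enumerated.residues-permute enum refl (G→member gen-zero) enum-next scan-succeeds
      where
      generators : ∀ x → G x ⇔ ⟨ enum 1 ∷ enum 2 ∷ enum 3 ∷ [] ⟩ x
      generators x = mk⇔ (subst (λ S → ⟨ S ⟩ x) (sym same)) (subst (λ S → ⟨ S ⟩ x) same)
        where
        same : enum 1 ∷ enum 2 ∷ enum 3 ∷ [] ≡ gens
        same = cong₂ _∷_ enum-1 (cong₂ _∷_ enum-2 (cong₂ _∷_ enum-3 refl))

lemma4p10 : ∀ (k : ℕ) → 1 ≤ k →
    (∀ x → ⟨ (6 * k + 3) ∷ (6 * k + 3 + 2) ∷ (2 * (6 * k + 3) ∸ 2) ∷ [] ⟩ x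
             ⇔ (∃ λ q → ∃ λ r → ∃ λ u → r ≤ q ×
                  x ≡ (q + 2 * u) * (6 * k + 3) + 2 * r ∸ 2 * u))
    × IsPermutationNS 3 ⟨ (6 * k + 3) ∷ (6 * k + 3 + 2) ∷ (2 * (6 * k + 3) ∸ 2) ∷ [] ⟩
lemma4p10 k 1≤k = G⇔combination , is-permutation 1≤k
  where
  open Semigroup k
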